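{- Let $D$ be a digraph with $\lambda(D)\ge 2$ which has a good pair $(B_s^+,B_s^-)$, where $B_s^+$ is an out-branching rooted at $s$ and $B_s^-$ is an in-branching rooted at $s$, the two being arc-disjoint. If there is a vertex $t$ of $D$ such that both $st$ and $ts$ are arcs of $D$, then $D$ has a good pair $(B_t^+,B_t^-)$ consisting of an out-branching rooted at $t$ and an in-branching rooted at $t$.
   Context: Digraphs have no loops and no multiple arcs. An out-branching (in-branching) of $D$ is a spanning tree of the underlying graph whose arcs are oriented in $D$ so that every vertex except the root has in-degree (out-degree) exactly one in the tree. A good pair is an arc-disjoint pair of an out-branching and an in-branching. $\lambda(D)$ denotes the arc-connectivity of $D$ (the minimum number of arcs leaving a nonempty proper vertex subset). -}

module Defs where

open import Data.Nat using (ℕ; zero; suc; _∸_; _≥_)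
open import Data.Bool using (Bool; true; false; if_then_else_; not; _∧_)
open import Data.Fin using (Fin)
open import Data.List using (List; map; allFin)
open import Data.Nat.ListAction using (sum)
open import Data.Product using (_×_; Σ; ∃; _,_)
open import Data.Sum using (_⊎_)
open import Relation.Binary.PropositionalEquality using (_≡_; _≢_)
open import Relation.Binary.Construct.Closure.ReflexiveTransitive using (Star)

-- A digraph on vertex set Fin n: a Boolean adjacency relation (so no
-- multiple arcs) with no loops.
record Digraph (n : ℕ) : Set where
  field
    arc    : Fin n → Fin n → Bool
    noLoop : ∀ v → arc v v ≡ false
open Digraph public

ArcSet : ℕ → Set
ArcSet n = Fin n → Fin n → Bool

Σv : ∀ {n} → (Fin n → ℕ) → ℕ
Σv {n} f = sum (map f (allFin n))

b2n : Bool → ℕ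
b2n true  = 1
b2n false = 0

size : ∀ {n} → ArcSet n → ℕ
size T = Σv (λ u → Σv (λ v → b2n (T u v)))

inDeg outDeg : ∀ {n} → ArcSet n → Fin n → ℕ
inDeg  T v = Σv (λ u → b2n (T u v))
outDeg T v = Σv (λ u → b2n (T v u))

SubOf : ∀ {n} → ArcSet n → Digraph n → Set
SubOf T D = ∀ u v → T u v ≡ true → arc D u v ≡ true

UAdj : ∀ {n} → ArcSet n → Fin n → Fin n → Set
UAdj T x y = T x y ≡ true ⊎ T y x ≡ true

SpanningTree : ∀ {n} → ArcSet n → Set
SpanningTree {n} T = (∀ u v → Star (UAdj T) u v) × size T ≡ n ∸ 1

OutBranching : ∀ {n} → Digraph n → Fin n → ArcSet n → Set
OutBranching D s T =
  SubOf T D × SpanningTree T × (∀ v → v ≢ s → inDeg T v ≡ 1)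

InBranching : ∀ {n} → Digraph n → Fin n → ArcSet n → Set
InBranching D s T =
  SubOf T D × SpanningTree T × (∀ v → v ≢ s → outDeg T v ≡ 1)

ArcDisjoint : ∀ {n} → ArcSet n → ArcSet n → Set
ArcDisjoint T₁ T₂ = ∀ u v → T₁ u v ≡ true → T₂ u v ≡ false

GoodPairAt : ∀ {n} → Digraph n → Fin n → Set
GoodPairAt {n} D s = Σ (ArcSet n) λ B⁺ → Σ (ArcSet n) λ B⁻ →
    OutBranching D s B⁺ × InBranching D s B⁻ × ArcDisjoint B⁺ B⁻

VSet : ℕ → Set
VSet n = Fin n → Bool

outArcs : ∀ {n} → Digraph n → VSet n → ℕ
outArcs D X = Σv (λ u → Σv (λ v → b2n (X u ∧ not (X v) ∧ arc D u v)))

NonemptyProper : ∀ {n} → VSet n → Set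
NonemptyProper X = (∃ λ u → X u ≡ true) × (∃ λ v → X v ≡ false)

ArcConnAtLeast : ∀ {n} → Digraph n → ℕ → Set
ArcConnAtLeast D k = ∀ X → NonemptyProper X → outArcs D X ≥ k

-- In the in-branching B⁻ₛ, drop the out-arc of t and add the arc st.
-- Every vertex still reaches t: its path to s either meets t, where it is
-- cut, or reaches s and continues along st; the out-degree count (t now a
-- sink, every other vertex of out-degree one) then yields a spanning tree.
-- Dually, in B⁺ₛ the in-arc of t is replaced by ts. The only new arcs are
-- st and ts, and neither can lie in the other new branching, because t is
-- a source of the out-branching and a sink of the in-branching.
module Submission where

open import Defs
open import Data.Bool using (Bool; true; false)
open import Data.Bool.Properties using (¬-not)
open import Data.Fin using (Fin; zero; suc; punchIn; _≟_)
open import Data.Fin.Properties using (punchInᵢ≢i; punchIn-punchOut)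
open import Data.List using (tabulate)
open import Data.List.Properties using (map-tabulate)
open import Data.Nat using (ℕ; zero; suc; _+_; _*_; _∸_)
open import Data.Nat.Properties
  using (+-0-commutativeMonoid; +-cancelʳ-≡; suc-injective; 1+n≢0; *-zeroʳ; *-identityʳ)
import Data.Nat.ListAction as List
open import Algebra.Properties.CommutativeMonoid.Sum +-0-commutativeMonoid
  using (sum; sum-cong-≗; sum-remove; ∑-comm)
open import Data.Product using (_×_; _,_)
open import Data.Sum using (_⊎_; inj₁; inj₂; swap)
open import Function using (_∘_; id; flip)
open import Relation.Binary.Construct.Closure.ReflexiveTransitive
  using (Star; ε; _◅_; _◅◅_; gmap; reverse)
open import Relation.Binary.PropositionalEquality
open import Relation.Nullary using (¬_; Dec; yes; no; does; contradiction)
open import Relation.Nullary.Decidable using (dec-true; dec-false)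

Σv≡sum : ∀ {n} (f : Fin n → ℕ) → Σv f ≡ sum f
Σv≡sum f = trans (cong List.sum (map-tabulate id f)) (sum-tabulate f)
  where
  sum-tabulate : ∀ {n} (f : Fin n → ℕ) → List.sum (tabulate f) ≡ sum f
  sum-tabulate {zero}  f = refl
  sum-tabulate {suc n} f = cong (f zero +_) (sum-tabulate (f ∘ suc))

Σv-cong : ∀ {n} {f g : Fin n → ℕ} → f ≗ g → Σv f ≡ Σv g
Σv-cong {f = f} {g} f≗g = begin
  Σv f   ≡⟨ Σv≡sum f ⟩
  sum f  ≡⟨ sum-cong-≗ f≗g ⟩
  sum g  ≡⟨ Σv≡sum g ⟨
  Σv g   ∎
  where open ≡-Reasoning

Σv-comm : ∀ {m n} (f : Fin m → Fin n → ℕ) →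
          Σv (λ u → Σv (λ v → f u v)) ≡ Σv (λ v → Σv (λ u → f u v))
Σv-comm {m} {n} f = begin
  Σv (λ u → Σv (λ v → f u v))    ≡⟨ Σv-cong (λ u → Σv≡sum (f u)) ⟩
  Σv (λ u → sum (λ v → f u v))   ≡⟨ Σv≡sum {m} _ ⟩
  sum (λ u → sum (λ v → f u v))  ≡⟨ ∑-comm f ⟩
  sum (λ v → sum (λ u → f u v))  ≡⟨ Σv≡sum {n} _ ⟨
  Σv (λ v → sum (λ u → f u v))   ≡⟨ Σv-cong (λ v → Σv≡sum (λ u → f u v)) ⟨
  Σv (λ v → Σv (λ u → f u v))    ∎
  where open ≡-Reasoning

Σv-remove : ∀ {n} (f : Fin (suc n) → ℕ) i → Σv f ≡ f i + Σv (f ∘ punchIn i)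
Σv-remove f i = trans (Σv≡sum f)
  (trans (sum-remove f) (cong (f i +_) (sym (Σv≡sum (f ∘ punchIn i)))))

Σv-const : ∀ {n} c → Σv {n} (λ _ → c) ≡ n * c
Σv-const {n} c = trans (Σv≡sum {n} (λ _ → c)) (sum-const n)
  where
  sum-const : ∀ n → sum {n} (λ _ → c) ≡ n * c
  sum-const zero    = refl
  sum-const (suc n) = cong (c +_) (sum-const n)

Σv-ones-except : ∀ {n} (f : Fin n → ℕ) r → (∀ v → v ≢ r → f v ≡ 1) →
                 Σv f ≡ f r + (n ∸ 1)
Σv-ones-except {suc n} f r f≡1 = begin
  Σv f                       ≡⟨ Σv-remove f r ⟩
  f r + Σv (f ∘ punchIn r)   ≡⟨ cong (f r +_) (Σv-cong (λ j → f≡1 _ (punchInᵢ≢i r j))) ⟩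
  f r + Σv {n} (λ _ → 1)     ≡⟨ cong (f r +_) (trans (Σv-const {n} 1) (*-identityʳ n)) ⟩
  f r + n                    ∎
  where open ≡-Reasoning

Σv-indicator : ∀ {n} (t : Fin n) → Σv (λ v → b2n (does (v ≟ t))) ≡ 1
Σv-indicator {suc n} t = begin
  Σv (λ v → b2n (does (v ≟ t)))                        ≡⟨ Σv-remove _ t ⟩
  b2n (does (t ≟ t)) + Σv (λ j → b2n (does (punchIn t j ≟ t)))
    ≡⟨ cong₂ _+_ (cong b2n (dec-true (t ≟ t) refl))
                 (Σv-cong (λ j → cong b2n (dec-false (punchIn t j ≟ t) (punchInᵢ≢i t j)))) ⟩
  1 + Σv {n} (λ _ → 0)                                 ≡⟨ cong suc (trans (Σv-const {n} 0) (*-zeroʳ n)) ⟩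
  1                                                    ∎
  where open ≡-Reasoning

Σv-remove-true : ∀ {n} (g : Fin (suc n) → Bool) {x} → g x ≡ true →
                 Σv (b2n ∘ g) ≡ 1 + Σv (b2n ∘ g ∘ punchIn x)
Σv-remove-true g {x} gx =
  trans (Σv-remove (b2n ∘ g) x) (cong (λ b → b2n b + Σv (b2n ∘ g ∘ punchIn x)) gx)

count≡0⇒none : ∀ {n} (g : Fin n → Bool) → Σv (b2n ∘ g) ≡ 0 → ∀ x → g x ≢ true
count≡0⇒none {suc n} g none x gx = 1+n≢0 (trans (sym (Σv-remove-true g gx)) none)

count≡1⇒unique : ∀ {n} (g : Fin n → Bool) → Σv (b2n ∘ g) ≡ 1 →
                 ∀ {x y} → g x ≡ true → g y ≡ true → x ≡ y
count≡1⇒unique {suc n} g one {x} {y} gx gy with y ≟ x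
... | yes y≡x = sym y≡x
... | no  y≢x = contradiction gy
  (subst (λ z → g z ≢ true) (punchIn-punchOut (y≢x ∘ sym))
         (count≡0⇒none (g ∘ punchIn x) rest≡0 _))
  where
  rest≡0 : Σv (b2n ∘ g ∘ punchIn x) ≡ 0
  rest≡0 = suc-injective (trans (sym (Σv-remove-true g gx)) one)

Arc : ∀ {n} → ArcSet n → Fin n → Fin n → Set
Arc T u v = T u v ≡ true

module _ {n} {D : Digraph n} {r : Fin n} {T : ArcSet n} where

  inBranching-root-sink : InBranching D r T → ∀ v → ¬ Arc T r v
  inBranching-root-sink (_ , (_ , size≡) , outDeg≡1) =
    count≡0⇒none (T r) (+-cancelʳ-≡ (n ∸ 1) (outDeg T r) 0
      (trans (sym (Σv-ones-except (outDeg T) r outDeg≡1)) size≡))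

  inBranching-unique-out : InBranching D r T →
                           ∀ {u v w} → Arc T u v → Arc T u w → v ≡ w
  inBranching-unique-out B@(_ , _ , outDeg≡1) {u} uv uw with u ≟ r
  ... | yes refl = contradiction uv (inBranching-root-sink B _)
  ... | no  u≢r  = count≡1⇒unique (T u) (outDeg≡1 u u≢r) uv uw

  inBranching-reaches-root : InBranching D r T → ∀ w → Star (Arc T) w r
  inBranching-reaches-root B@(_ , (connected , _) , _) w = follow ε (connected r w)
    where
    -- A forward arc u → v of the walk is the first arc of u's path to r,
    -- since u has only one out-arc.
    follow : ∀ {u w} → Star (Arc T) u r → Star (UAdj T) u w → Star (Arc T) w r
    follow p        ε              = p
    follow p        (inj₂ vu ◅ q)  = follow (vu ◅ p) q
    follow ε        (inj₁ rv ◅ _)  = contradiction rv (inBranching-root-sink B _)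
    follow (uv′ ◅ p) (inj₁ uv ◅ q) with inBranching-unique-out B uv′ uv
    ... | refl = follow p q

  inBranching-intro : SubOf T D → outDeg T r ≡ 0 → (∀ v → v ≢ r → outDeg T v ≡ 1) →
                      (∀ w → Star (Arc T) w r) → InBranching D r T
  inBranching-intro sub root≡0 outDeg≡1 reach =
    sub , (connected , size≡) , outDeg≡1
    where
    undirected : ∀ {u v} → Star (Arc T) u v → Star (UAdj T) u v
    undirected = gmap id inj₁

    connected : ∀ u v → Star (UAdj T) u v
    connected u v = undirected (reach u) ◅◅ reverse swap (undirected (reach v))

    size≡ : size T ≡ n ∸ 1
    size≡ = trans (Σv-ones-except (outDeg T) r outDeg≡1) (cong (_+ (n ∸ 1)) root≡0)

redirect : ∀ {n} → ArcSet n → Fin n → Fin n → ArcSet n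
redirect T s t u v with u ≟ t | u ≟ s
... | yes _ | _     = false
... | no _  | yes _ = does (v ≟ t)
... | no _  | no _  = T u v

module _ {n} (T : ArcSet n) (s t : Fin n) where

  redirect-target : ∀ v → redirect T s t t v ≡ false
  redirect-target v with t ≟ t | t ≟ s
  ... | yes _   | _ = refl
  ... | no  t≢t | _ = contradiction refl t≢t

  redirect-root : s ≢ t → ∀ v → redirect T s t s v ≡ does (v ≟ t)
  redirect-root s≢t v with s ≟ t | s ≟ s
  ... | yes s≡t | _       = contradiction s≡t s≢t
  ... | no  _   | yes _   = refl
  ... | no  _   | no  s≢s = contradiction refl s≢s

  redirect-other : ∀ {u} → u ≢ t → u ≢ s → ∀ v → redirect T s t u v ≡ T u v
  redirect-other {u} u≢t u≢s v with u ≟ t | u ≟ s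
  ... | yes u≡t | _       = contradiction u≡t u≢t
  ... | no  _   | yes u≡s = contradiction u≡s u≢s
  ... | no  _   | no  _   = refl

  redirect-arc : ∀ {u v} → Arc (redirect T s t) u v →
                 (u ≢ t × Arc T u v) ⊎ (u ≡ s × v ≡ t)
  redirect-arc {u} {v} a with u ≟ t | u ≟ s
  ... | yes _   | _       = contradiction a λ ()
  ... | no  u≢t | no  _   = inj₁ (u≢t , a)
  ... | no  _   | yes u≡s with v ≟ t
  ...   | yes v≡t = inj₂ (u≡s , v≡t)
  ...   | no  _   = contradiction a λ ()

redirect-inBranching : ∀ {n} {D : Digraph n} {s t : Fin n} {T : ArcSet n} →
                       InBranching D s T → arc D s t ≡ true → s ≢ t →
                       InBranching D t (redirect T s t)
redirect-inBranching {n} {D} {s} {t} {T} B@(T⊆D , _ , outDeg≡1) st s≢t =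
  inBranching-intro {D = D} T′⊆D outDeg-target outDeg-others reach
  where
  T′ : ArcSet n
  T′ = redirect T s t

  T′⊆D : SubOf T′ D
  T′⊆D u v a with redirect-arc T s t a
  ... | inj₁ (_ , uv)     = T⊆D u v uv
  ... | inj₂ (refl , refl) = st

  outDeg-target : outDeg T′ t ≡ 0
  outDeg-target = trans (Σv-cong (cong b2n ∘ redirect-target T s t))
                        (trans (Σv-const {n} 0) (*-zeroʳ n))

  outDeg-others : ∀ v → v ≢ t → outDeg T′ v ≡ 1
  outDeg-others v v≢t = by-cases (v ≟ s)
    where
    by-cases : Dec (v ≡ s) → outDeg T′ v ≡ 1
    by-cases (yes refl) = trans (Σv-cong (cong b2n ∘ redirect-root T s t s≢t)) (Σv-indicator t)
    by-cases (no  v≢s)  = trans (Σv-cong (cong b2n ∘ redirect-other T s t v≢t v≢s))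
                                (outDeg≡1 v v≢s)

  new-arc : Arc T′ s t
  new-arc = trans (redirect-root T s t s≢t t) (dec-true (t ≟ t) refl)

  to-target : ∀ {w} → Star (Arc T) w s → Star (Arc T′) w t
  to-target ε = new-arc ◅ ε
  to-target (_◅_ {i = w} a p) with w ≟ t
  ... | yes refl = ε
  ... | no  w≢t  = kept ◅ to-target p
    where
    kept : Arc T′ w _
    kept = trans (redirect-other T s t w≢t (λ { refl → inBranching-root-sink {D = D} B _ a }) _) a

  reach : ∀ w → Star (Arc T′) w t
  reach w = to-target (inBranching-reaches-root {D = D} B w)

converse : ∀ {n} → Digraph n → Digraph n
converse D = record { arc = flip (arc D) ; noLoop = noLoop D }

spanningTree-flip : ∀ {n} {T : ArcSet n} → SpanningTree T → SpanningTree (flip T)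
spanningTree-flip {T = T} (connected , size≡) =
  (λ u v → gmap id swap (connected u v)) ,
  trans (Σv-comm (λ u v → b2n (T v u))) size≡

outBranching⇒inBranching-converse : ∀ {n} {D : Digraph n} {s T} →
  OutBranching D s T → InBranching (converse D) s (flip T)
outBranching⇒inBranching-converse (sub , tree , inDeg≡1) =
  flip sub , spanningTree-flip tree , inDeg≡1

inBranching-converse⇒outBranching : ∀ {n} {D : Digraph n} {s T} →
  InBranching (converse D) s T → OutBranching D s (flip T)
inBranching-converse⇒outBranching (sub , tree , outDeg≡1) =
  flip sub , spanningTree-flip tree , outDeg≡1

redirect-arcDisjoint : ∀ {n} {B⁺ B⁻ : ArcSet n} {s t} → ArcDisjoint B⁺ B⁻ →
  ArcDisjoint (flip (redirect (flip B⁺) s t)) (redirect B⁻ s t)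
redirect-arcDisjoint {B⁺ = B⁺} {B⁻} {s} {t} disjoint u v a⁺ =
  ¬-not (λ a⁻ → clash (redirect-arc (flip B⁺) s t a⁺) a⁻)
  where
  clash : (v ≢ t × Arc B⁺ u v) ⊎ (v ≡ s × u ≡ t) → ¬ Arc (redirect B⁻ s t) u v
  clash (inj₂ (refl , refl)) a⁻ with () ← trans (sym a⁻) (redirect-target B⁻ s t s)
  clash (inj₁ (v≢t , uv)) a⁻ with redirect-arc B⁻ s t a⁻
  ... | inj₂ (_ , v≡t) = v≢t v≡t
  ... | inj₁ (_ , uv⁻) with () ← trans (sym uv⁻) (disjoint u v uv)

proposition1 : ∀ {n} (D : Digraph n) (s t : Fin n) →
    ArcConnAtLeast D 2 → GoodPairAt D s →
    arc D s t ≡ true → arc D t s ≡ true →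
    GoodPairAt D t
proposition1 D s t _ (B⁺ , B⁻ , B⁺-out , B⁻-in , disjoint) st ts =
  flip (redirect (flip B⁺) s t) , redirect B⁻ s t ,
  inBranching-converse⇒outBranching {D = D}
    (redirect-inBranching {D = converse D}
      (outBranching⇒inBranching-converse {D = D} B⁺-out) ts s≢t) ,
  redirect-inBranching {D = D} B⁻-in st s≢t ,
  redirect-arcDisjoint {B⁺ = B⁺} disjoint
  where
  s≢t : s ≢ t
  s≢t refl with () ← trans (sym st) (noLoop D s)
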